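{- Let $p\in\mathbb{Z}_{\ge0}$ and let $s$ be a positive integer such that $i\oplus s=i+s$ for $i=0,1,\dots,p$. Let $j\in\mathbb{Z}_{\ge0}$ with $0\le j\le p$. Then $\{j\oplus i: i=0,1,\dots,s-1\}=\{0,1,\dots,s-1\}$.
   Context: $\oplus$ denotes nim-sum (bitwise XOR of binary expansions). -}

module Defs where

open import Data.Nat using (ℕ; zero; suc; _+_; _*_)
open import Data.Nat.DivMod using (_/_; _%_)

-- The first argument is fuel; fuel ≥ (number of binary digits of m and n)
-- suffices, and m + n is always enough (each step halves both arguments).
xorAux : ℕ → ℕ → ℕ → ℕ
xorAux zero    m n = 0
xorAux (suc k) m n = bit (m % 2) (n % 2) + 2 * xorAux k (m / 2) (n / 2)
  where
  bit : ℕ → ℕ → ℕ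
  bit zero    zero    = 0
  bit zero    (suc _) = 1
  bit (suc _) zero    = 1
  bit (suc _) (suc _) = 0

infixl 6 _⊕_
_⊕_ : ℕ → ℕ → ℕ
m ⊕ n = xorAux (m + n) m n

-- If every i ≤ j adds to s without carry, then either j = 0 or s is even (take i = 1),
-- and halving j, i and s preserves the hypothesis; so binary induction on s shows that
-- j ⊕ _ maps {0, …, s − 1} into itself. Being an involution, it then maps it onto itself.

module Submission where

open import Defs
open import Data.Bool.Base using (Bool; true; false; _xor_)
open import Data.Bool.Properties using (xor-assoc; xor-same)
open import Data.Empty using (⊥-elim)
open import Data.Nat using (ℕ; zero; suc; _+_; _*_; _≤_; _<_; NonZero; z≤n; s≤s)
open import Data.Nat.DivMod using (_/_; _%_; [m+kn]%n≡m%n; m<n⇒m%n≡m; m<n⇒m/n≡0; +-distrib-/; m*n/n≡m; m*n%n≡0; m/n*n≤m)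
open import Data.Nat.Induction using (<-rec)
open import Data.Nat.Properties
open import Data.Product using (Σ; _×_; _,_)
open import Function.Bundles using (_⇔_; mk⇔)
open import Relation.Binary.PropositionalEquality

bit : Bool → ℕ
bit false = 0
bit true  = 1

bit<2 : ∀ b → bit b < 2
bit<2 false = s≤s z≤n
bit<2 true  = s≤s (s≤s z≤n)

data Binary : ℕ → Set where
  digit : (b : Bool) (a : ℕ) → Binary (bit b + a * 2)

binary : ∀ n → Binary n
binary zero = digit false 0
binary (suc n) with binary n
... | digit false a = digit true a
... | digit true  a = digit false (suc a)

binaryInduction : ∀ {ℓ} (P : ℕ → Set ℓ) → P 0 →
                  (∀ b a → P a → P (bit b + a * 2)) → ∀ n → P n
binaryInduction P P0 step = <-rec P go
  where
  go : ∀ n → (∀ {m} → m < n → P m) → P n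
  go n rec with binary n
  ... | digit false zero    = P0
  ... | digit false (suc a) = step false (suc a) (rec (s≤s (s≤s (m≤m*n a 2))))
  ... | digit true  a       = step true a (rec (s≤s (m≤m*n a 2)))

[bit+a*2]%2≡bit : ∀ b a → (bit b + a * 2) % 2 ≡ bit b
[bit+a*2]%2≡bit b a = trans ([m+kn]%n≡m%n (bit b) a 2) (m<n⇒m%n≡m (bit<2 b))

[bit+a*2]/2≡a : ∀ b a → (bit b + a * 2) / 2 ≡ a
[bit+a*2]/2≡a b a = begin
  (bit b + a * 2) / 2       ≡⟨ +-distrib-/ (bit b) (a * 2) bound ⟩
  bit b / 2 + a * 2 / 2     ≡⟨ cong₂ _+_ (m<n⇒m/n≡0 (bit<2 b)) (m*n/n≡m a 2) ⟩
  a                         ∎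
  where
  open ≡-Reasoning
  bound : bit b % 2 + a * 2 % 2 < 2
  bound = subst (_< 2) (cong₂ _+_ (sym (m<n⇒m%n≡m (bit<2 b))) (sym (m*n%n≡0 a 2)))
                (subst (_< 2) (sym (+-identityʳ (bit b))) (bit<2 b))

-- The digit function of xorAux is local to Defs; it only becomes visible once applied to concrete bits.
xorAux-digit : ∀ k x y a c →
               xorAux (suc k) (bit x + a * 2) (bit y + c * 2) ≡ bit (x xor y) + xorAux k a c * 2
xorAux-digit k x y a c
  rewrite [bit+a*2]%2≡bit x a | [bit+a*2]%2≡bit y c | [bit+a*2]/2≡a x a | [bit+a*2]/2≡a y c
  with x | y
... | false | false = *-comm 2 (xorAux k a c)
... | false | true  = cong suc (*-comm 2 (xorAux k a c))
... | true  | false = cong suc (*-comm 2 (xorAux k a c))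
... | true  | true  = *-comm 2 (xorAux k a c)

m+n≤1+k⇒m/2+n/2≤k : ∀ m n k → m + n ≤ suc k → m / 2 + n / 2 ≤ k
m+n≤1+k⇒m/2+n/2≤k m n k m+n≤1+k = half (begin
  (m / 2 + n / 2) * 2     ≡⟨ *-distribʳ-+ 2 (m / 2) (n / 2) ⟩
  m / 2 * 2 + n / 2 * 2   ≤⟨ +-mono-≤ (m/n*n≤m m 2) (m/n*n≤m n 2) ⟩
  m + n                   ≤⟨ m+n≤1+k ⟩
  suc k                   ∎)
  where
  open ≤-Reasoning
  half : ∀ {a f} → a * 2 ≤ suc f → a ≤ f
  half {zero}  _         = z≤n
  half {suc a} (s≤s 2a≤f) = ≤-trans (s≤s (m≤m*n a 2)) 2a≤f

xorAux-fuel-irrelevant : ∀ k k′ m n → m + n ≤ k → m + n ≤ k′ → xorAux k m n ≡ xorAux k′ m n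
xorAux-fuel-irrelevant zero     zero     m       n       _ _ = refl
xorAux-fuel-irrelevant zero     (suc k′) zero    zero    _ _ =
  cong (2 *_) (xorAux-fuel-irrelevant 0 k′ 0 0 z≤n z≤n)
xorAux-fuel-irrelevant (suc k)  zero     zero    zero    _ _ =
  cong (2 *_) (xorAux-fuel-irrelevant k 0 0 0 z≤n z≤n)
xorAux-fuel-irrelevant (suc k)  (suc k′) m       n       ≤k ≤k′ with binary m | binary n
... | digit x a | digit y c = begin
  xorAux (suc k) (bit x + a * 2) (bit y + c * 2)   ≡⟨ xorAux-digit k x y a c ⟩
  bit (x xor y) + xorAux k a c * 2                  ≡⟨ cong (λ r → bit (x xor y) + r * 2) IH ⟩
  bit (x xor y) + xorAux k′ a c * 2                 ≡⟨ xorAux-digit k′ x y a c ⟨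
  xorAux (suc k′) (bit x + a * 2) (bit y + c * 2)  ∎
  where
  open ≡-Reasoning
  halved : ∀ {f} → bit x + a * 2 + (bit y + c * 2) ≤ suc f → a + c ≤ f
  halved {f} ≤f = subst (_≤ f) (cong₂ _+_ ([bit+a*2]/2≡a x a) ([bit+a*2]/2≡a y c))
                         (m+n≤1+k⇒m/2+n/2≤k (bit x + a * 2) (bit y + c * 2) f ≤f)
  IH : xorAux k a c ≡ xorAux k′ a c
  IH = xorAux-fuel-irrelevant k k′ a c (halved ≤k) (halved ≤k′)

⊕-digit : ∀ x y a c → (bit x + a * 2) ⊕ (bit y + c * 2) ≡ bit (x xor y) + (a ⊕ c) * 2
⊕-digit x y a c = begin
  m ⊕ n
    ≡⟨ xorAux-fuel-irrelevant (m + n) (suc (m + n)) m n ≤-refl (n≤1+n _) ⟩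
  xorAux (suc (m + n)) m n
    ≡⟨ xorAux-digit (m + n) x y a c ⟩
  bit (x xor y) + xorAux (m + n) a c * 2
    ≡⟨ cong (λ r → bit (x xor y) + r * 2) (xorAux-fuel-irrelevant (m + n) (a + c) a c a+c≤m+n ≤-refl) ⟩
  bit (x xor y) + (a ⊕ c) * 2
    ∎
  where
  open ≡-Reasoning
  m n : ℕ
  m = bit x + a * 2
  n = bit y + c * 2
  a+c≤m+n : a + c ≤ m + n
  a+c≤m+n = +-mono-≤ (≤-trans (m≤m*n a 2) (m≤n+m _ (bit x))) (≤-trans (m≤m*n c 2) (m≤n+m _ (bit y)))

⊕-identityˡ : ∀ n → 0 ⊕ n ≡ n
⊕-identityˡ = binaryInduction (λ n → 0 ⊕ n ≡ n) refl
  (λ b a 0⊕a≡a → trans (⊕-digit false b 0 a) (cong (λ r → bit b + r * 2) 0⊕a≡a))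

⊕-involutive : ∀ j x → j ⊕ (j ⊕ x) ≡ x
⊕-involutive = binaryInduction (λ j → ∀ x → j ⊕ (j ⊕ x) ≡ x)
  (λ x → trans (⊕-identityˡ (0 ⊕ x)) (⊕-identityˡ x)) step
  where
  step : ∀ b a → (∀ x → a ⊕ (a ⊕ x) ≡ x) → ∀ x → (bit b + a * 2) ⊕ ((bit b + a * 2) ⊕ x) ≡ x
  step b a ih x with binary x
  ... | digit c d = begin
    (bit b + a * 2) ⊕ ((bit b + a * 2) ⊕ (bit c + d * 2))  ≡⟨ cong ((bit b + a * 2) ⊕_) (⊕-digit b c a d) ⟩
    (bit b + a * 2) ⊕ (bit (b xor c) + (a ⊕ d) * 2)         ≡⟨ ⊕-digit b (b xor c) a (a ⊕ d) ⟩
    bit (b xor (b xor c)) + (a ⊕ (a ⊕ d)) * 2               ≡⟨ cong₂ (λ e r → bit e + r * 2) b⊕b⊕c≡c (ih d) ⟩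
    bit c + d * 2                                            ∎
    where
    open ≡-Reasoning
    b⊕b⊕c≡c : b xor (b xor c) ≡ c
    b⊕b⊕c≡c = trans (sym (xor-assoc b b c)) (cong (_xor c) (xor-same b))

CarryFreeUpTo : ℕ → ℕ → Set
CarryFreeUpTo j s = ∀ i → i ≤ j → i ⊕ s ≡ i + s

carryFree⇒even : ∀ {j b a} → CarryFreeUpTo (suc j) (bit b + a * 2) → b ≡ false
carryFree⇒even {b = false}     _  = refl
carryFree⇒even {b = true}  {a} cf = ⊥-elim (m≢1+m+n (a * 2) (begin
  a * 2                 ≡⟨ cong (_* 2) (⊕-identityˡ a) ⟨
  (0 ⊕ a) * 2           ≡⟨ ⊕-digit true true 0 a ⟨
  1 ⊕ suc (a * 2)       ≡⟨ cf 1 (s≤s z≤n) ⟩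
  suc (suc (a * 2))     ≡⟨ cong suc (+-comm 1 (a * 2)) ⟩
  suc (a * 2 + 1)       ∎))
  where open ≡-Reasoning

carryFree-half : ∀ {x a b} → CarryFreeUpTo (bit x + a * 2) (b * 2) → CarryFreeUpTo a b
carryFree-half {x} {a} {b} cf i i≤a = *-cancelʳ-≡ (i ⊕ b) (i + b) 2 (begin
  (i ⊕ b) * 2        ≡⟨ ⊕-digit false false i b ⟨
  (i * 2) ⊕ (b * 2)  ≡⟨ cf (i * 2) (≤-trans (*-monoˡ-≤ 2 i≤a) (m≤n+m (a * 2) (bit x))) ⟩
  i * 2 + b * 2      ≡⟨ *-distribʳ-+ 2 i b ⟨
  (i + b) * 2        ∎)
  where open ≡-Reasoning

c<a⇒bit+c*2<a*2 : ∀ y c a → c < a → bit y + c * 2 < a * 2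
c<a⇒bit+c*2<a*2 y c a c<a = ≤-trans (+-monoˡ-< (c * 2) (bit<2 y)) (*-monoˡ-≤ 2 c<a)

bit+c*2<a*2⇒c<a : ∀ y c a → bit y + c * 2 < a * 2 → c < a
bit+c*2<a*2⇒c<a y c a <a*2 = *-cancelʳ-< 2 c a (≤-<-trans (m≤n+m (c * 2) (bit y)) <a*2)

carryFree⇒⊕-< : ∀ s j → CarryFreeUpTo j s → ∀ i → i < s → j ⊕ i < s
carryFree⇒⊕-< = binaryInduction P (λ _ _ _ ()) step
  where
  P : ℕ → Set
  P s = ∀ j → CarryFreeUpTo j s → ∀ i → i < s → j ⊕ i < s
  digitwise : ∀ {a j i} → P a → Binary j → Binary i → CarryFreeUpTo j (a * 2) → i < a * 2 → j ⊕ i < a * 2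
  digitwise {a} ih (digit x c) (digit y d) cf i<s = begin-strict
    (bit x + c * 2) ⊕ (bit y + d * 2)  ≡⟨ ⊕-digit x y c d ⟩
    bit (x xor y) + (c ⊕ d) * 2        <⟨ c<a⇒bit+c*2<a*2 (x xor y) (c ⊕ d) a c⊕d<a ⟩
    a * 2                              ∎
    where
    open ≤-Reasoning
    c⊕d<a : c ⊕ d < a
    c⊕d<a = ih c (carryFree-half cf) d (bit+c*2<a*2⇒c<a y d a i<s)
  step : ∀ b a → P a → P (bit b + a * 2)
  step b a ih zero    _  i i<s = subst (_< bit b + a * 2) (sym (⊕-identityˡ i)) i<s
  step b a ih (suc j) cf i i<s with carryFree⇒even {b = b} {a} cf
  ... | refl = digitwise ih (binary (suc j)) (binary i) cf i<s

mainTheorem16 : (p s : ℕ) → NonZero s →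
    ((i : ℕ) → i ≤ p → i ⊕ s ≡ i + s) →
    (j : ℕ) → j ≤ p →
    (x : ℕ) → (Σ ℕ (λ i → i < s × j ⊕ i ≡ x)) ⇔ x < s
mainTheorem16 p s _ cf j j≤p x = mk⇔ to from
  where
  cfʲ : CarryFreeUpTo j s
  cfʲ i i≤j = cf i (≤-trans i≤j j≤p)
  to : Σ ℕ (λ i → i < s × j ⊕ i ≡ x) → x < s
  to (i , i<s , refl) = carryFree⇒⊕-< s j cfʲ i i<s
  from : x < s → Σ ℕ (λ i → i < s × j ⊕ i ≡ x)
  from x<s = j ⊕ x , carryFree⇒⊕-< s j cfʲ x x<s , ⊕-involutive j x
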